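{- A sequence $(a_h)_{h\in\mathbb{Z}}\subset\{+1,-1\}$ is a complete folding sequence if and only if, for each $n\in\mathbb{N}$, there exists $h_n\in\mathbb{Z}$ such that $a_{h_n+k2^{n+1}}=(-1)^k a_{h_n}$ for each $k\in\mathbb{Z}$.
   Context: All sequences take values in $\{+1,-1\}$. For $S=(a_1,\dots,a_n)$ write $\overline{S}=(-a_n,\dots,-a_1)$. The $n$-folding sequences are defined recursively: the only $0$-folding sequence is the empty sequence, and the $(n+1)$-folding sequences are exactly $(\overline{S},+1,S)$ and $(\overline{S},-1,S)$ with $S$ an $n$-folding sequence. A finite sequence $(u_1,\dots,u_m)$ is a subword of a sequence $(b_k)$ if there is $h$ with $u_k=b_{k+h}$ for $1\le k\le m$. A finite folding sequence is a subword of some $n$-folding sequence; a complete folding sequence is a sequence $(a_k)_{k\in\mathbb{Z}}$ all of whose finite subwords are finite folding sequences. -}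

module Defs where

open import Data.Sign.Base using (Sign; opposite) renaming (_*_ to _*ₛ_; + to plus; - to minus) public
open import Data.Nat using (ℕ; zero; suc)
open import Data.Integer using (ℤ; +_; -[1+_]; _+_)
open import Data.List using (List; []; _∷_; _++_; reverse; map; length)
open import Data.Product using (Σ; ∃; ∃-syntax; _×_; _,_)
open import Relation.Binary.PropositionalEquality using (_≡_)

bar : List Sign → List Sign
bar S = reverse (map opposite S)

data Folding : ℕ → List Sign → Set where
  fold-zero : Folding zero []
  fold-suc  : ∀ {n S} (s : Sign) → Folding n S → Folding (suc n) (bar S ++ s ∷ S)

SubwordOf : List Sign → List Sign → Set
SubwordOf u b = ∃[ pre ] ∃[ post ] b ≡ pre ++ u ++ post

FiniteFolding : List Sign → Set
FiniteFolding u = ∃[ n ] ∃[ S ] Folding n S × SubwordOf u S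

window : (ℤ → Sign) → ℤ → ℕ → List Sign
window a i zero    = []
window a i (suc m) = a i ∷ window a (i + + 1) m

CompleteFolding : (ℤ → Sign) → Set
CompleteFolding a = ∀ (i : ℤ) (m : ℕ) → FiniteFolding (window a i m)

parityℕ : ℕ → Sign
parityℕ zero    = plus
parityℕ (suc n) = opposite (parityℕ n)

negOnePow : ℤ → Sign
negOnePow (+ n)      = parityℕ n
negOnePow -[1+ n ]   = parityℕ (suc n)

module Submission where

-- Fix fold choices t : ℕ → {±1}.  The paperfolding sign at p = 2^v (2j+1) is
-- foldSign t p = (−1)^j t v, and the N-folding sequences are exactly the words
-- (foldSign t 1, …, foldSign t (2^N − 1)): the recursion S ↦ (S̄, s, S) is the splitting of
-- the positions below 2^(N+1) at the middle one, 2^N (module Paperfolding).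
-- Rigidity (module Rigidity): along a progression of step 2^(n+1), the signs foldSign t change
-- three times in a row only if the progression runs through positions of 2-adic valuation n,
-- and then they change at every step.
-- (⇒) Every window of a complete folding sequence is a stretch of some foldSign t.  A window
-- at 0 contains a point h whose progression alternates three times; rigidity in ever longer
-- windows around h spreads this alternation to all k (module Forward).
-- (⇐) The alternation points of all levels can be made coherent: there are anchors c with
-- a (c + p) = foldSign t p for 0 < p < 2^(m+1), where t v = a (c + 2^v), so every window lies
-- inside a paperfolding word (module Backward).

open import Defs
open import Data.Nat using (ℕ)
open import Data.Integer using (ℤ)

module Paperfolding where

  open import Data.Nat
  open import Data.Nat.Properties
  open import Data.Nat.Tactic.RingSolver using (solve-∀)
  open import Data.List using (List; []; _∷_; _++_; reverse; map; applyUpTo; applyDownFrom)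
  open import Data.List.Properties using (map-applyUpTo; reverse-applyUpTo; ∷-injectiveˡ; ∷-injectiveʳ)
  open import Data.Parity.Base as ℙ using (Parity; 0ℙ; 1ℙ)
  import Data.Parity.Properties as ℙₚ
  import Data.Sign.Properties as 𝕊
  open import Data.Product using (∃-syntax; _×_; _,_; proj₂)
  open import Data.Empty using (⊥; ⊥-elim)
  open import Function using (_∘_)
  open import Relation.Nullary using (¬_; contradiction; yes; no)
  open import Relation.Binary.Definitions using (tri<; tri≈; tri>)
  open import Relation.Binary.PropositionalEquality

  opposite-*ˡ : ∀ a b → opposite (a *ₛ b) ≡ opposite a *ₛ b
  opposite-*ˡ a b = sym (𝕊.*-assoc minus a b)

  opposite-*ʳ : ∀ a b → opposite (a *ₛ b) ≡ a *ₛ opposite b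
  opposite-*ʳ plus  b = refl
  opposite-*ʳ minus b = refl

  opposite-product-plus : ∀ a b → opposite (a *ₛ b) ≡ plus → a ≡ opposite b
  opposite-product-plus plus  minus _ = refl
  opposite-product-plus minus plus  _ = refl

  sign-transpose : ∀ s x y → x ≡ s *ₛ y → y ≡ s *ₛ x
  sign-transpose plus  x y e = sym e
  sign-transpose minus x y e = trans (sym (𝕊.opposite-involutive y)) (cong opposite (sym e))

  parityℕ-+ : ∀ m n → parityℕ (m + n) ≡ parityℕ m *ₛ parityℕ n
  parityℕ-+ zero    n = refl
  parityℕ-+ (suc m) n = trans (cong opposite (parityℕ-+ m n)) (opposite-*ˡ (parityℕ m) (parityℕ n))

  parityℕ-double : ∀ m → parityℕ (m + m) ≡ plus
  parityℕ-double m = trans (parityℕ-+ m m) (𝕊.s*s≡+ (parityℕ m))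

  data EvenOdd : ℕ → Set where
    even : ∀ q → EvenOdd (q + q)
    odd  : ∀ q → EvenOdd (suc (q + q))

  evenOdd : ∀ p → EvenOdd p
  evenOdd zero = even zero
  evenOdd (suc p) with evenOdd p
  ... | even q = odd q
  ... | odd q  = subst EvenOdd (cong suc (+-suc q q)) (even (suc q))

  double-injective : ∀ m n → m + m ≡ n + n → m ≡ n
  double-injective m n e = trans (n≡⌊n+n/2⌋ m) (trans (cong ⌊_/2⌋ e) (sym (n≡⌊n+n/2⌋ n)))

  double≢suc-double : ∀ m n → m + m ≢ suc (n + n)
  double≢suc-double m n e = 𝕊.s≢opposite[s] plus
    (trans (sym (parityℕ-double m)) (trans (cong parityℕ e) (cong opposite (parityℕ-double n))))

  parity-even : ∀ q → parity (q + q) ≡ 0ℙ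
  parity-even q = trans (ℙₚ.+-homo-+ q q) (ℙₚ.p+p≡0ℙ (parity q))

  parity-odd : ∀ q → parity (suc (q + q)) ≡ 1ℙ
  parity-odd q = trans (ℙₚ.+-homo-+ 1 (q + q)) (cong (1ℙ ℙ.+_) (parity-even q))

  -- The paperfolding sign at position p ≥ 1 for the fold choices t : ℕ → Sign:
  -- writing p = 2^v (2j+1), it is (−1)^j t v.  It is computed by halving p,
  -- with an explicit fuel argument f that only has to bound p.
  byParity : Parity → Sign → Sign → Sign
  byParity 0ℙ x y = x
  byParity 1ℙ x y = y

  foldSignFuel : ℕ → (ℕ → Sign) → ℕ → Sign
  foldSignFuel zero    t p = plus
  foldSignFuel (suc f) t p =
    byParity (parity p) (foldSignFuel f (t ∘ suc) ⌊ p /2⌋) (parityℕ ⌊ p /2⌋ *ₛ t 0)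

  foldSignFuel-zero : ∀ f t → foldSignFuel f t 0 ≡ plus
  foldSignFuel-zero zero    t = refl
  foldSignFuel-zero (suc f) t = foldSignFuel-zero f (t ∘ suc)

  foldSignFuel-irrelevant : ∀ f g t p → p ≤ f → p ≤ g → foldSignFuel f t p ≡ foldSignFuel g t p
  foldSignFuel-irrelevant f g t zero _ _ = trans (foldSignFuel-zero f t) (sym (foldSignFuel-zero g t))
  foldSignFuel-irrelevant (suc f) (suc g) t (suc p) (s≤s p≤f) (s≤s p≤g) =
    cong (λ x → byParity (parity (suc p)) x (parityℕ ⌊ suc p /2⌋ *ₛ t 0))
         (foldSignFuel-irrelevant f g (t ∘ suc) ⌊ suc p /2⌋ (≤-trans half≤p p≤f) (≤-trans half≤p p≤g))
    where
    half≤p : ⌊ suc p /2⌋ ≤ p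
    half≤p = s≤s⁻¹ (⌊n/2⌋<n p)

  foldSign : (ℕ → Sign) → ℕ → Sign
  foldSign t p = foldSignFuel p t p

  foldSign-even : ∀ t q → foldSign t (q + q) ≡ foldSign (t ∘ suc) q
  foldSign-even t zero    = refl
  foldSign-even t (suc q) = trans (halve {q + suc q} (suc q))
    (foldSignFuel-irrelevant (q + suc q) (suc q) (t ∘ suc) (suc q) (m≤n+m (suc q) q) ≤-refl)
    where
    halve : ∀ {f} q → foldSignFuel (suc f) t (q + q) ≡ foldSignFuel f (t ∘ suc) q
    halve q rewrite parity-even q | sym (n≡⌊n+n/2⌋ q) = refl

  foldSign-odd : ∀ t q → foldSign t (suc (q + q)) ≡ parityℕ q *ₛ t 0
  foldSign-odd t q rewrite parity-odd q = cong (λ h → parityℕ h *ₛ t 0) (sym (n≡⌈n+n/2⌉ q))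

  -- Powers of two, defined by doubling so that pow2 (suc n) unfolds to a sum.
  pow2 : ℕ → ℕ
  pow2 zero    = 1
  pow2 (suc n) = pow2 n + pow2 n

  pow2≡2^ : ∀ n → pow2 n ≡ 2 ^ n
  pow2≡2^ zero    = refl
  pow2≡2^ (suc n) = cong₂ _+_ (pow2≡2^ n) (trans (pow2≡2^ n) (sym (+-identityʳ (2 ^ n))))

  pow2-positive : ∀ n → 1 ≤ pow2 n
  pow2-positive zero    = ≤-refl
  pow2-positive (suc n) = ≤-trans (pow2-positive n) (m≤m+n (pow2 n) (pow2 n))

  pow2-+ : ∀ m n → pow2 (m + n) ≡ pow2 m * pow2 n
  pow2-+ zero    n = sym (+-identityʳ (pow2 n))
  pow2-+ (suc m) n = trans (cong₂ _+_ (pow2-+ m n) (pow2-+ m n)) (sym (*-distribʳ-+ (pow2 n) (pow2 m) (pow2 m)))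

  pow2-mono : ∀ {m n} → m ≤ n → pow2 m ≤ pow2 n
  pow2-mono {zero}  {n}     _         = pow2-positive n
  pow2-mono {suc m} {suc n} (s≤s m≤n) = +-mono-≤ (pow2-mono m≤n) (pow2-mono m≤n)

  n<pow2 : ∀ n → n < pow2 n
  n<pow2 zero    = s≤s z≤n
  n<pow2 (suc n) = +-mono-≤ (pow2-positive n) (n<pow2 n)

  parityℕ-pow2-+ : ∀ n p → parityℕ (pow2 (suc n) + p) ≡ parityℕ p
  parityℕ-pow2-+ n p = trans (parityℕ-+ (pow2 (suc n)) p) (cong (_*ₛ parityℕ p) (parityℕ-double (pow2 n)))

  -- dyadic v j = 2^v (2j+1): the positive integer of 2-adic valuation v and odd part 2j+1.
  dyadic : ℕ → ℕ → ℕ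
  dyadic zero    j = suc (j + j)
  dyadic (suc v) j = dyadic v j + dyadic v j

  dyadic-zero : ∀ v → dyadic v 0 ≡ pow2 v
  dyadic-zero zero    = refl
  dyadic-zero (suc v) = cong₂ _+_ (dyadic-zero v) (dyadic-zero v)

  dyadic≡ : ∀ v j → dyadic v j ≡ pow2 v + j * pow2 (suc v)
  dyadic≡ zero    j = odd≡ j
    where
    odd≡ : ∀ j → suc (j + j) ≡ 1 + j * 2
    odd≡ = solve-∀
  dyadic≡ (suc v) j = begin
    dyadic v j + dyadic v j                                      ≡⟨ cong₂ _+_ (dyadic≡ v j) (dyadic≡ v j) ⟩
    (pow2 v + j * pow2 (suc v)) + (pow2 v + j * pow2 (suc v))    ≡⟨ double-distrib (pow2 v) (pow2 (suc v)) j ⟩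
    pow2 (suc v) + j * pow2 (suc (suc v))                        ∎
    where
    open ≡-Reasoning
    double-distrib : ∀ a b j → (a + j * b) + (a + j * b) ≡ (a + a) + j * (b + b)
    double-distrib = solve-∀

  dyadic-progression : ∀ v j i → dyadic v j + i * pow2 (suc v) ≡ dyadic v (j + i)
  dyadic-progression v j i = begin
    dyadic v j + i * P                ≡⟨ cong (_+ i * P) (dyadic≡ v j) ⟩
    pow2 v + j * P + i * P            ≡⟨ collect (pow2 v) j i P ⟩
    pow2 v + (j + i) * P              ≡⟨ sym (dyadic≡ v (j + i)) ⟩
    dyadic v (j + i)                  ∎
    where
    open ≡-Reasoning
    P = pow2 (suc v)
    collect : ∀ a j i P → a + j * P + i * P ≡ a + (j + i) * P
    collect = solve-∀

  dyadic-suc : ∀ v j → dyadic v j + pow2 (suc v) ≡ dyadic v (suc j)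
  dyadic-suc v j = trans (cong (dyadic v j +_) (sym (+-identityʳ (pow2 (suc v)))))
                         (trans (dyadic-progression v j 1) (cong (dyadic v) (+-comm j 1)))

  foldSign-dyadic : ∀ t v j → foldSign t (dyadic v j) ≡ parityℕ j *ₛ t v
  foldSign-dyadic t zero    j = foldSign-odd t j
  foldSign-dyadic t (suc v) j = trans (foldSign-even t (dyadic v j)) (foldSign-dyadic (t ∘ suc) v j)

  foldSign-pow2 : ∀ t v → foldSign t (pow2 v) ≡ t v
  foldSign-pow2 t v = trans (cong (foldSign t) (sym (dyadic-zero v))) (foldSign-dyadic t v 0)

  dyadic-decomposition : ∀ p → 1 ≤ p → ∃[ v ] ∃[ j ] p ≡ dyadic v j
  dyadic-decomposition p = by-parity p (evenOdd p) ≤-refl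
    where
    -- the fuel f bounds p, so halving terminates
    by-parity : ∀ f {p} → EvenOdd p → p ≤ f → 1 ≤ p → ∃[ v ] ∃[ j ] p ≡ dyadic v j
    by-parity f       (odd r)        _     _ = 0 , r , refl
    by-parity (suc f) (even (suc q)) 2q≤f′ _
      with by-parity f (evenOdd (suc q)) (≤-trans (m≤n+m (suc q) q) (s≤s⁻¹ 2q≤f′)) z<s
    ... | v , j , e = suc v , j , cong (λ x → x + x) e

  pow2≤dyadic : ∀ v j → pow2 v ≤ dyadic v j
  pow2≤dyadic v j = subst (pow2 v ≤_) (sym (dyadic≡ v j)) (m≤m+n (pow2 v) (j * pow2 (suc v)))

  dyadic-below : ∀ M v j → dyadic v j < pow2 (suc M) → ¬ (v < M) → v ≡ M × j ≡ 0
  dyadic-below M v j lt v≮M with <-cmp v M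
  ... | tri< v<M _ _ = contradiction v<M v≮M
  ... | tri> _ _ M<v = contradiction (≤-trans (pow2-mono M<v) (pow2≤dyadic v j)) (<⇒≱ lt)
  dyadic-below M v zero    lt v≮M | tri≈ _ v≡M _ = v≡M , refl
  dyadic-below M v (suc j) lt v≮M | tri≈ _ refl _ =
    contradiction (subst (pow2 (suc v) ≤_) (dyadic-suc v j) (m≤n+m (pow2 (suc v)) (dyadic v j))) (<⇒≱ lt)

  dyadic-within : ∀ n s → ∃[ e ] e < pow2 (suc n) × ∃[ j ] s + e ≡ dyadic n j
  dyadic-within n zero = pow2 n , m<m+n (pow2 n) (pow2-positive n) , 0 , sym (dyadic-zero n)
  dyadic-within n (suc s) with dyadic-within n s
  ... | suc e , e< , j , eq = e , <-trans (n<1+n e) e< , j , trans (sym (+-suc s e)) eq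
  ... | zero  , _  , j , eq = L ∸ 1 , ∸-monoʳ-< {o = 0} z<s L-positive , suc j , (begin
    suc s + (L ∸ 1)        ≡⟨ sym (+-suc s (L ∸ 1)) ⟩
    s + (1 + (L ∸ 1))      ≡⟨ cong (s +_) (m+[n∸m]≡n L-positive) ⟩
    s + L                  ≡⟨ cong (_+ L) (trans (sym (+-identityʳ s)) eq) ⟩
    dyadic n j + L         ≡⟨ dyadic-suc n j ⟩
    dyadic n (suc j)       ∎)
    where
    open ≡-Reasoning
    L = pow2 (suc n)
    L-positive : 1 ≤ L
    L-positive = pow2-positive (suc n)

  -- t' is t with the choice at level M flipped.
  FlipAt : ℕ → (ℕ → Sign) → (ℕ → Sign) → Set
  FlipAt M t t' = t' M ≡ opposite (t M) × (∀ v → v < M → t' v ≡ t v)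

  FlipAt-suc : ∀ M {t t'} → FlipAt (suc M) t t' → FlipAt M (t ∘ suc) (t' ∘ suc)
  FlipAt-suc M (flip , same) = flip , λ v v<M → same (suc v) (s≤s v<M)

  foldSign-shift : ∀ M {t t'} → FlipAt M t t' → ∀ p → 1 ≤ p → p < pow2 (suc M) →
                   foldSign t (pow2 (suc M) + p) ≡ foldSign t' p
  foldSign-shift zero (flip , _) (suc zero) _ _ = sym flip
  foldSign-shift zero _ (suc (suc p)) _ (s≤s (s≤s ()))
  foldSign-shift (suc M) {t} {t'} flipAt p 1≤p p< = by-parity (evenOdd p) 1≤p p<
    where
    open ≡-Reasoning
    P = pow2 (suc M)
    by-parity : ∀ {p} → EvenOdd p → 1 ≤ p → p < P + P → foldSign t (P + P + p) ≡ foldSign t' p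
    by-parity (even zero)    ()
    by-parity (even (suc q)) _ p< = begin
      foldSign t (P + P + (suc q + suc q))        ≡⟨ cong (foldSign t) (regroup P (suc q)) ⟩
      foldSign t ((P + suc q) + (P + suc q))      ≡⟨ foldSign-even t (P + suc q) ⟩
      foldSign (t ∘ suc) (P + suc q)              ≡⟨ foldSign-shift M (FlipAt-suc M flipAt) (suc q) (s≤s z≤n) (halve p<) ⟩
      foldSign (t' ∘ suc) (suc q)                 ≡⟨ sym (foldSign-even t' (suc q)) ⟩
      foldSign t' (suc q + suc q)                 ∎
      where
      regroup : ∀ P q → P + P + (q + q) ≡ (P + q) + (P + q)
      regroup = solve-∀
      halve : suc q + suc q < P + P → suc q < P
      halve lt = ≰⇒> (λ P≤q → <⇒≱ lt (+-mono-≤ P≤q P≤q))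
    by-parity (odd q) _ _ = begin
      foldSign t (P + P + suc (q + q))            ≡⟨ cong (foldSign t) (regroup P q) ⟩
      foldSign t (suc ((P + q) + (P + q)))        ≡⟨ foldSign-odd t (P + q) ⟩
      parityℕ (P + q) *ₛ t 0                      ≡⟨ cong (_*ₛ t 0) (parityℕ-pow2-+ M q) ⟩
      parityℕ q *ₛ t 0                            ≡⟨ cong (parityℕ q *ₛ_) (sym (proj₂ flipAt 0 z<s)) ⟩
      parityℕ q *ₛ t' 0                           ≡⟨ sym (foldSign-odd t' q) ⟩
      foldSign t' (suc (q + q))                   ∎
      where
      regroup : ∀ P q → P + P + suc (q + q) ≡ suc ((P + q) + (P + q))
      regroup = solve-∀

  foldSign-mirror : ∀ M {t t'} → FlipAt M t t' → ∀ p r → 1 ≤ p → 1 ≤ r → p + r ≡ pow2 (suc M) →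
                    foldSign t p ≡ opposite (foldSign t' r)
  foldSign-mirror zero {t} (flip , _) 1 1 _ _ _ =
    trans (sym (𝕊.opposite-involutive (t 0))) (cong opposite (sym flip))
  foldSign-mirror zero _ 1 (suc (suc r)) _ _ ()
  foldSign-mirror zero _ (suc (suc p)) (suc r) _ _ e = ⊥-elim (m+1+n≢0 p (suc-injective (suc-injective e)))
  foldSign-mirror (suc M) {t} {t'} flipAt p r 1≤p 1≤r e = by-parity (evenOdd p) (evenOdd r) 1≤p 1≤r e
    where
    open ≡-Reasoning
    P = pow2 (suc M)
    by-parity : ∀ {p r} → EvenOdd p → EvenOdd r → 1 ≤ p → 1 ≤ r → p + r ≡ P + P →
                foldSign t p ≡ opposite (foldSign t' r)
    by-parity (even zero) _ () _ _
    by-parity _ (even zero) _ () _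
    by-parity (even (suc q)) (even (suc s)) _ _ e = begin
      foldSign t (suc q + suc q)             ≡⟨ foldSign-even t (suc q) ⟩
      foldSign (t ∘ suc) (suc q)             ≡⟨ foldSign-mirror M (FlipAt-suc M flipAt) (suc q) (suc s) z<s z<s
                                                   (double-injective _ _ (trans (interchange (suc q) (suc s)) e)) ⟩
      opposite (foldSign (t' ∘ suc) (suc s)) ≡⟨ cong opposite (sym (foldSign-even t' (suc s))) ⟩
      opposite (foldSign t' (suc s + suc s)) ∎
      where
      interchange : ∀ q s → (q + s) + (q + s) ≡ (q + q) + (s + s)
      interchange = solve-∀
    by-parity (odd q) (odd s) _ _ e = begin
      foldSign t (suc (q + q))               ≡⟨ foldSign-odd t q ⟩
      parityℕ q *ₛ t 0                       ≡⟨ cong (_*ₛ t 0) complementary ⟩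
      opposite (parityℕ s) *ₛ t 0            ≡⟨ sym (opposite-*ˡ (parityℕ s) (t 0)) ⟩
      opposite (parityℕ s *ₛ t 0)            ≡⟨ cong (λ x → opposite (parityℕ s *ₛ x)) (sym (proj₂ flipAt 0 z<s)) ⟩
      opposite (parityℕ s *ₛ t' 0)           ≡⟨ cong opposite (sym (foldSign-odd t' s)) ⟩
      opposite (foldSign t' (suc (s + s)))   ∎
      where
      interchange : ∀ q s → suc (q + q) + suc (s + s) ≡ suc (q + s) + suc (q + s)
      interchange = solve-∀
      half-sum : suc (q + s) ≡ P
      half-sum = double-injective _ _ (trans (sym (interchange q s)) e)
      -- q + s + 1 = 2^(M+1) is even, so q and s have opposite parities
      complementary : parityℕ q ≡ opposite (parityℕ s)
      complementary = opposite-product-plus (parityℕ q) (parityℕ s)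
        (trans (cong opposite (sym (parityℕ-+ q s)))
          (trans (cong parityℕ half-sum) (parityℕ-double (pow2 M))))
    by-parity (even (suc q)) (odd s) _ _ e =
      ⊥-elim (double≢suc-double P (suc q + s) (sym (trans (sym (regroup (suc q) s)) e)))
      where
      regroup : ∀ q s → (q + q) + suc (s + s) ≡ suc ((q + s) + (q + s))
      regroup = solve-∀
    by-parity (odd q) (even (suc s)) _ _ e =
      ⊥-elim (double≢suc-double P (q + suc s) (sym (trans (sym (regroup q (suc s))) e)))
      where
      regroup : ∀ q s → suc (q + q) + (s + s) ≡ suc ((q + s) + (q + s))
      regroup = solve-∀

  applyUpTo-cong : ∀ n {f g : ℕ → Sign} → (∀ x → x < n → f x ≡ g x) → applyUpTo f n ≡ applyUpTo g n
  applyUpTo-cong zero    eq = refl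
  applyUpTo-cong (suc n) eq = cong₂ _∷_ (eq 0 z<s) (applyUpTo-cong n (λ x x<n → eq (suc x) (s≤s x<n)))

  applyUpTo-++ : ∀ m n (f : ℕ → Sign) → applyUpTo f (m + n) ≡ applyUpTo f m ++ applyUpTo (λ x → f (m + x)) n
  applyUpTo-++ zero    n f = refl
  applyUpTo-++ (suc m) n f = cong (f 0 ∷_) (applyUpTo-++ m n (f ∘ suc))

  applyDownFrom≡applyUpTo : ∀ n (f : ℕ → Sign) → applyDownFrom f n ≡ applyUpTo (λ x → f (n ∸ suc x)) n
  applyDownFrom≡applyUpTo zero    f = refl
  applyDownFrom≡applyUpTo (suc n) f = cong (f n ∷_) (applyDownFrom≡applyUpTo n f)

  bar-applyUpTo : ∀ n (f : ℕ → Sign) → bar (applyUpTo f n) ≡ applyUpTo (λ x → opposite (f (n ∸ suc x))) n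
  bar-applyUpTo n f = begin
    reverse (map opposite (applyUpTo f n))       ≡⟨ cong reverse (map-applyUpTo f opposite n) ⟩
    reverse (applyUpTo (opposite ∘ f) n)         ≡⟨ reverse-applyUpTo (opposite ∘ f) n ⟩
    applyDownFrom (opposite ∘ f) n               ≡⟨ applyDownFrom≡applyUpTo n (opposite ∘ f) ⟩
    applyUpTo (λ x → opposite (f (n ∸ suc x))) n ∎
    where open ≡-Reasoning

  -- 2^N − 1, the length of an N-folding sequence.
  foldLength : ℕ → ℕ
  foldLength zero    = 0
  foldLength (suc N) = foldLength N + suc (foldLength N)

  suc-foldLength : ∀ N → suc (foldLength N) ≡ pow2 N
  suc-foldLength zero    = refl
  suc-foldLength (suc N) = cong₂ _+_ (suc-foldLength N) (suc-foldLength N)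

  foldWord : (ℕ → Sign) → ℕ → List Sign
  foldWord t N = applyUpTo (foldSign t ∘ suc) (foldLength N)

  -- The word of length 2^(M+2) − 1 is the word of length 2^(M+1) − 1 for t flipped at M,
  -- folded around the middle letter t (M+1): exactly the recursion of folding sequences.
  foldWord-unfold : ∀ M {t t'} → FlipAt M t t' →
                    foldWord t (suc (suc M)) ≡ bar (foldWord t' (suc M)) ++ t (suc M) ∷ foldWord t' (suc M)
  foldWord-unfold M {t} {t'} flipAt = begin
    applyUpTo g (n + suc n)                                        ≡⟨ applyUpTo-++ n (suc n) g ⟩
    applyUpTo g n ++ g (n + 0) ∷ applyUpTo (λ x → g (n + suc x)) n ≡⟨ cong₂ _++_ left (cong₂ _∷_ middle right) ⟩
    bar (foldWord t' (suc M)) ++ t (suc M) ∷ foldWord t' (suc M)   ∎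
    where
    open ≡-Reasoning
    n = foldLength (suc M)
    P = pow2 (suc M)
    g : ℕ → Sign
    g = foldSign t ∘ suc
    1+n≡P : suc n ≡ P
    1+n≡P = suc-foldLength (suc M)
    middle : g (n + 0) ≡ t (suc M)
    middle = trans (cong (foldSign t) (trans (cong suc (+-identityʳ n)) 1+n≡P)) (foldSign-pow2 t (suc M))
    right : applyUpTo (λ x → g (n + suc x)) n ≡ foldWord t' (suc M)
    right = applyUpTo-cong n λ x x<n →
      trans (cong (foldSign t) (cong (_+ suc x) 1+n≡P))
            (foldSign-shift M flipAt (suc x) z<s (subst (suc x <_) 1+n≡P (s≤s x<n)))
    left : applyUpTo g n ≡ bar (foldWord t' (suc M))
    left = sym (trans (bar-applyUpTo n (foldSign t' ∘ suc)) (applyUpTo-cong n λ x x<n →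
      sym (foldSign-mirror M flipAt (suc x) (suc (n ∸ suc x)) z<s z<s
        (trans (cong suc (+-suc x (n ∸ suc x))) (trans (cong suc (m+[n∸m]≡n x<n)) 1+n≡P)))))

  updateAt : ℕ → Sign → (ℕ → Sign) → ℕ → Sign
  updateAt k s t v with v ≟ k
  ... | yes _ = s
  ... | no  _ = t v

  updateAt-here : ∀ k s t → updateAt k s t k ≡ s
  updateAt-here k s t with k ≟ k
  ... | yes _   = refl
  ... | no  k≢k = contradiction refl k≢k

  updateAt-elsewhere : ∀ k s t {v} → v ≢ k → updateAt k s t v ≡ t v
  updateAt-elsewhere k s t {v} v≢k with v ≟ k
  ... | yes v≡k = contradiction v≡k v≢k
  ... | no  _   = refl

  foldWord-isFolding : ∀ N t → Folding N (foldWord t N)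
  foldWord-isFolding zero          t = fold-zero
  foldWord-isFolding (suc zero)    t = fold-suc (t 0) fold-zero
  foldWord-isFolding (suc (suc M)) t =
    subst (Folding (suc (suc M))) (sym (foldWord-unfold M flipAt))
      (fold-suc (t (suc M)) (foldWord-isFolding (suc M) t'))
    where
    t' = updateAt M (opposite (t M)) t
    flipAt : FlipAt M t t'
    flipAt = updateAt-here M (opposite (t M)) t , λ v v<M → updateAt-elsewhere M _ t (<⇒≢ v<M)

  folding-isFoldWord : ∀ {N S} → Folding N S → ∃[ t ] S ≡ foldWord t N
  folding-isFoldWord fold-zero = (λ _ → plus) , refl
  folding-isFoldWord (fold-suc {zero} s fold-zero) = (λ _ → s) , refl
  folding-isFoldWord (fold-suc {suc M} s folding) with folding-isFoldWord folding
  ... | t' , refl = t , sym (begin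
    foldWord t (suc (suc M))                                        ≡⟨ foldWord-unfold M flipAt ⟩
    bar (foldWord t' (suc M)) ++ t (suc M) ∷ foldWord t' (suc M)
      ≡⟨ cong (λ x → bar (foldWord t' (suc M)) ++ x ∷ foldWord t' (suc M)) (updateAt-here (suc M) s t₀) ⟩
    bar (foldWord t' (suc M)) ++ s ∷ foldWord t' (suc M)             ∎)
    where
    open ≡-Reasoning
    -- flip level M of t', then put s at level M + 1
    t₀ = updateAt M (opposite (t' M)) t'
    t  = updateAt (suc M) s t₀
    below : ∀ {v} → v ≤ M → t v ≡ t₀ v
    below v≤M = updateAt-elsewhere (suc M) s t₀ (<⇒≢ (s≤s v≤M))
    flipAt : FlipAt M t t'
    flipAt = trans (sym (𝕊.opposite-involutive (t' M)))
                   (cong opposite (sym (trans (below ≤-refl) (updateAt-here M _ t')))) ,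
             λ v v<M → sym (trans (below (<⇒≤ v<M)) (updateAt-elsewhere M _ t' (<⇒≢ v<M)))

  subword-of-applyUpTo : ∀ {m K} {f g : ℕ → Sign} → SubwordOf (applyUpTo f m) (applyUpTo g K) →
                         ∃[ d ] ∀ x → x < m → f x ≡ g (d + x)
  subword-of-applyUpTo {m} {K} {f} {g} ([] , post , e) = 0 , prefix m K f g e
    where
    prefix : ∀ m K (f g : ℕ → Sign) {post} → applyUpTo g K ≡ applyUpTo f m ++ post →
             ∀ x → x < m → f x ≡ g x
    prefix (suc m) (suc K) f g e zero    _         = sym (∷-injectiveˡ e)
    prefix (suc m) (suc K) f g e (suc x) (s≤s x<m) = prefix m K (f ∘ suc) (g ∘ suc) (∷-injectiveʳ e) x x<m
  subword-of-applyUpTo {K = suc K} {g = g} (_ ∷ pre , post , e)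
    with subword-of-applyUpTo {K = K} {g = g ∘ suc} (pre , post , ∷-injectiveʳ e)
  ... | d , shifted = suc d , shifted

  applyUpTo-segment : ∀ r m n (g : ℕ → Sign) → r + m ≤ n →
                      SubwordOf (applyUpTo (λ x → g (r + x)) m) (applyUpTo g n)
  applyUpTo-segment r m n g r+m≤n = applyUpTo g r , applyUpTo (λ x → g (r + (m + x))) rest , (begin
    applyUpTo g n                                    ≡⟨ cong (applyUpTo g) n≡ ⟩
    applyUpTo g (r + (m + rest))                     ≡⟨ applyUpTo-++ r (m + rest) g ⟩
    applyUpTo g r ++ applyUpTo (λ x → g (r + x)) (m + rest)
                                                     ≡⟨ cong (applyUpTo g r ++_) (applyUpTo-++ m rest (λ x → g (r + x))) ⟩
    applyUpTo g r ++ applyUpTo (λ x → g (r + x)) m ++ applyUpTo (λ x → g (r + (m + x))) rest ∎)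
    where
    open ≡-Reasoning
    rest = n ∸ (r + m)
    n≡ : n ≡ r + (m + rest)
    n≡ = trans (sym (m+[n∸m]≡n r+m≤n)) (+-assoc r m rest)

-- Rigidity of paperfolding signs along arithmetic progressions of step 2^(n+1).
module Rigidity where

  open Paperfolding
  open import Data.Nat
  open import Data.Nat.Properties
  open import Data.Nat.Tactic.RingSolver using (solve-∀)
  import Data.Sign.Properties as 𝕊
  open import Data.Product using (∃-syntax; _×_; _,_)
  open import Data.Empty using (⊥; ⊥-elim)
  open import Function using (_∘_)
  open import Relation.Nullary using (¬_)
  open import Relation.Nullary.Decidable using (True; toWitness)
  open import Relation.Binary.PropositionalEquality

  Flips : (ℕ → Sign) → ℕ → Set
  Flips u i = u (suc i) ≡ opposite (u i)

  ThreeFlips : (ℕ → Sign) → ℕ → Set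
  ThreeFlips u i = Flips u i × Flips u (suc i) × Flips u (suc (suc i))

  Flips-transfer : ∀ u v {i j} → v j ≡ u i → v (suc j) ≡ u (suc i) → Flips u i → Flips v j
  Flips-transfer u v eⱼ eⱼ₊₁ f = trans eⱼ₊₁ (trans f (cong opposite (sym eⱼ)))

  ThreeFlips-transfer : ∀ u v m m' → (∀ i → i ≤ 3 → v (i + m') ≡ u (i + m)) →
                        ThreeFlips u m → ThreeFlips v m'
  ThreeFlips-transfer u v m m' e (f₀ , f₁ , f₂) =
    Flips-transfer u v {m} {m'} (at 0) (at 1) f₀ ,
    Flips-transfer u v {suc m} {suc m'} (at 1) (at 2) f₁ ,
    Flips-transfer u v {suc (suc m)} {suc (suc m')} (at 2) (at 3) f₂
    where
    at : ∀ i {i≤3 : True (i ≤? 3)} → v (i + m') ≡ u (i + m)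
    at i {i≤3} = e i (toWitness i≤3)

  two-flips-return : ∀ u i → Flips u i → Flips u (suc i) → u (suc (suc i)) ≡ u i
  two-flips-return u i f₀ f₁ = trans f₁ (trans (cong opposite f₀) (𝕊.opposite-involutive (u i)))

  alternating-from-flips : ∀ {u} → (∀ i → Flips u i) → ∀ i → u i ≡ parityℕ i *ₛ u 0
  alternating-from-flips         flips zero    = refl
  alternating-from-flips {u} flips (suc i) =
    trans (flips i) (trans (cong opposite (alternating-from-flips flips i)) (opposite-*ˡ (parityℕ i) (u 0)))

  progression : (ℕ → Sign) → ℕ → ℕ → ℕ → Sign
  progression t s L i = foldSign t (s + i * L)

  dyadic-flips : ∀ n t j i → Flips (progression t (dyadic n j) (pow2 (suc n))) i
  dyadic-flips n t j i = begin
    progression t (dyadic n j) (pow2 (suc n)) (suc i)   ≡⟨ cong (foldSign t) (dyadic-progression n j (suc i)) ⟩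
    foldSign t (dyadic n (j + suc i))                    ≡⟨ foldSign-dyadic t n (j + suc i) ⟩
    parityℕ (j + suc i) *ₛ t n                           ≡⟨ cong (λ k → parityℕ k *ₛ t n) (+-suc j i) ⟩
    opposite (parityℕ (j + i)) *ₛ t n                    ≡⟨ sym (opposite-*ˡ (parityℕ (j + i)) (t n)) ⟩
    opposite (parityℕ (j + i) *ₛ t n)                    ≡⟨ cong opposite (sym (foldSign-dyadic t n (j + i))) ⟩
    opposite (foldSign t (dyadic n (j + i)))             ≡⟨ cong (opposite ∘ foldSign t) (sym (dyadic-progression n j i)) ⟩
    opposite (progression t (dyadic n j) (pow2 (suc n)) i) ∎
    where open ≡-Reasoning

  foldSign-odd-step : ∀ t q → foldSign t (suc (suc q + suc q)) ≡ opposite (foldSign t (suc (q + q)))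
  foldSign-odd-step t q = begin
    foldSign t (suc (suc q + suc q))    ≡⟨ foldSign-odd t (suc q) ⟩
    opposite (parityℕ q) *ₛ t 0         ≡⟨ sym (opposite-*ˡ (parityℕ q) (t 0)) ⟩
    opposite (parityℕ q *ₛ t 0)         ≡⟨ cong opposite (sym (foldSign-odd t q)) ⟩
    opposite (foldSign t (suc (q + q))) ∎
    where open ≡-Reasoning

  -- With step 1 the signs never change three times in a row: four consecutive positions
  -- contain two odd ones at distance 2, whose signs differ although two flips restore a sign.
  no-three-flips-step1 : ∀ t q → ¬ ThreeFlips (progression t q 1) 0
  no-three-flips-step1 t q flips = by-parity flips (evenOdd q)
    where
    odd-pair : ∀ {q} i r → progression t q 1 (2 + i) ≡ progression t q 1 i →
               q + i * 1 ≡ suc (r + r) → q + (2 + i) * 1 ≡ suc (suc r + suc r) → ⊥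
    odd-pair {q} i r ret eᵢ eᵢ₊₂ = 𝕊.s≢opposite[s] (foldSign t (q + i * 1)) (begin
      foldSign t (q + i * 1)               ≡⟨ sym ret ⟩
      foldSign t (q + (2 + i) * 1)         ≡⟨ cong (foldSign t) eᵢ₊₂ ⟩
      foldSign t (suc (suc r + suc r))     ≡⟨ foldSign-odd-step t r ⟩
      opposite (foldSign t (suc (r + r)))  ≡⟨ cong (opposite ∘ foldSign t) (sym eᵢ) ⟩
      opposite (foldSign t (q + i * 1))    ∎)
      where open ≡-Reasoning
    position-0 : ∀ r → suc (r + r) + 0 * 1 ≡ suc (r + r)
    position-0 = solve-∀
    position-2 : ∀ r → suc (r + r) + 2 * 1 ≡ suc (suc r + suc r)
    position-2 = solve-∀
    position-1 : ∀ r → (r + r) + 1 * 1 ≡ suc (r + r)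
    position-1 = solve-∀
    position-3 : ∀ r → (r + r) + 3 * 1 ≡ suc (suc r + suc r)
    position-3 = solve-∀
    by-parity : ∀ {q} → ThreeFlips (progression t q 1) 0 → EvenOdd q → ⊥
    by-parity {q} (f₀ , f₁ , _) (odd r)  =
      odd-pair 0 r (two-flips-return (progression t q 1) 0 f₀ f₁) (position-0 r) (position-2 r)
    by-parity {q} (_ , f₁ , f₂) (even r) =
      odd-pair 1 r (two-flips-return (progression t q 1) 1 f₁ f₂) (position-1 r) (position-3 r)

  progression-halve : ∀ n t q i → progression (t ∘ suc) q (pow2 n) i ≡ progression t (q + q) (pow2 (suc n)) i
  progression-halve n t q i = begin
    foldSign (t ∘ suc) (q + i * P)                ≡⟨ sym (foldSign-even t (q + i * P)) ⟩
    foldSign t ((q + i * P) + (q + i * P))        ≡⟨ cong (foldSign t) (regroup q i P) ⟩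
    foldSign t (q + q + i * (P + P))              ∎
    where
    open ≡-Reasoning
    P = pow2 n
    regroup : ∀ q i P → (q + i * P) + (q + i * P) ≡ q + q + i * (P + P)
    regroup = solve-∀

  ThreeFlips-halve : ∀ n t q → ThreeFlips (progression t (q + q) (pow2 (suc n))) 0 →
                     ThreeFlips (progression (t ∘ suc) q (pow2 n)) 0
  ThreeFlips-halve n t q = ThreeFlips-transfer (progression t (q + q) (pow2 (suc n))) (progression (t ∘ suc) q (pow2 n))
                             0 0 (λ i _ → progression-halve n t q (i + 0))

  odd-no-flip : ∀ n t r → ¬ Flips (progression t (suc (r + r)) (pow2 (suc (suc n)))) 0
  odd-no-flip n t r f = 𝕊.s≢opposite[s] (u 0) (trans (sym same) f)
    where
    open ≡-Reasoning
    P = pow2 (suc n)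
    u = progression t (suc (r + r)) (P + P)
    step : ∀ r P → suc (r + r) + 1 * (P + P) ≡ suc ((P + r) + (P + r))
    step = solve-∀
    same : u 1 ≡ u 0
    same = begin
      u 1                                    ≡⟨ cong (foldSign t) (step r P) ⟩
      foldSign t (suc ((P + r) + (P + r)))   ≡⟨ foldSign-odd t (P + r) ⟩
      parityℕ (P + r) *ₛ t 0                 ≡⟨ cong (_*ₛ t 0) (parityℕ-pow2-+ n r) ⟩
      parityℕ r *ₛ t 0                       ≡⟨ sym (foldSign-odd t r) ⟩
      foldSign t (suc (r + r))               ≡⟨ cong (foldSign t) (sym (+-identityʳ (suc (r + r)))) ⟩
      u 0                                    ∎

  -- Odd s only works for n = 0; even s is halved, down to step 1 where it is impossible.
  three-flips⇒dyadic : ∀ n t s → ThreeFlips (progression t s (pow2 (suc n))) 0 → ∃[ j ] s ≡ dyadic n j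
  three-flips⇒dyadic n t s flips = by-parity n t flips (evenOdd s)
    where
    by-parity : ∀ n t {s} → ThreeFlips (progression t s (pow2 (suc n))) 0 → EvenOdd s → ∃[ j ] s ≡ dyadic n j
    by-parity zero    t _        (odd r)  = r , refl
    by-parity (suc n) t (f₀ , _) (odd r)  = ⊥-elim (odd-no-flip n t r f₀)
    by-parity zero    t flips    (even q) = ⊥-elim (no-three-flips-step1 (t ∘ suc) q (ThreeFlips-halve zero t q flips))
    by-parity (suc n) t flips    (even q) with by-parity n (t ∘ suc) (ThreeFlips-halve (suc n) t q flips) (evenOdd q)
    ... | j , q≡ = j , cong (λ k → k + k) q≡

  -- If s + m·2^(n+1) has valuation n, then so has s: such numbers are ≥ 2^n and ≡ 2^n mod 2^(n+1).
  dyadic-descend : ∀ n s m j → s + m * pow2 (suc n) ≡ dyadic n j → ∃[ j' ] s ≡ dyadic n j'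
  dyadic-descend n s zero    j e = j , trans (sym (+-identityʳ s)) e
  dyadic-descend n s (suc m) j e = step j (trans (regroup s m L) e)
    where
    L = pow2 (suc n)
    regroup : ∀ s m L → s + m * L + L ≡ s + (L + m * L)
    regroup = solve-∀
    step : ∀ j → s + m * L + L ≡ dyadic n j → ∃[ j' ] s ≡ dyadic n j'
    step zero    e′ = ⊥-elim (<⇒≱ (subst (_< L) (sym (dyadic-zero n)) (m<m+n (pow2 n) (pow2-positive n)))
                                  (subst (L ≤_) e′ (m≤n+m L (s + m * L))))
    step (suc j) e′ =
      dyadic-descend n s m j (+-cancelʳ-≡ L (s + m * L) (dyadic n j) (trans e′ (sym (dyadic-suc n j))))

  progression-rigid : ∀ n t s m → ThreeFlips (progression t s (pow2 (suc n))) m →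
                      ∀ i → Flips (progression t s (pow2 (suc n))) i
  progression-rigid n t s m flips with three-flips⇒dyadic n t (s + m * L) restarted
    where
    L = pow2 (suc n)
    regroup : ∀ s m i L → s + m * L + (i + 0) * L ≡ s + (i + m) * L
    regroup = solve-∀
    restarted : ThreeFlips (progression t (s + m * L) L) 0
    restarted = ThreeFlips-transfer (progression t s L) (progression t (s + m * L) L) m 0
                  (λ i _ → cong (foldSign t) (regroup s m i L)) flips
  ... | j , e with dyadic-descend n s m j e
  ...   | j' , refl = dyadic-flips n t j'

module OverIntegers where

  open Paperfolding using (opposite-*ʳ; applyUpTo-cong; EvenOdd; even; odd; evenOdd; pow2)
  open import Data.List using (_∷_; applyUpTo)
  open import Data.Nat as ℕ using (zero; suc)
  import Data.Nat.Properties as ℕₚ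
  open import Data.Integer using (+_; -[1+_]; _+_; _*_; _-_; -_; 1ℤ)
  import Data.Integer.Properties as ℤₚ
  open import Data.Integer.Tactic.RingSolver using (solve-∀)
  import Data.Sign.Properties as 𝕊
  open import Data.Product using (∃-syntax; _×_; _,_)
  open import Data.Sum using (_⊎_; inj₁; inj₂)
  open import Relation.Binary.PropositionalEquality

  ℤ-induction : (P : ℤ → Set) → P (+ 0) →
                (∀ k → P k → P (k + 1ℤ)) → (∀ k → P k → P (k - 1ℤ)) → ∀ k → P k
  ℤ-induction P base up down (+ zero)     = base
  ℤ-induction P base up down (+ suc n)    =
    subst P (cong +_ (ℕₚ.+-comm n 1)) (up (+ n) (ℤ-induction P base up down (+ n)))
  ℤ-induction P base up down -[1+ zero ]  = down (+ 0) base
  ℤ-induction P base up down -[1+ suc n ] =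
    subst P (cong (λ m → -[1+ suc m ]) (ℕₚ.+-identityʳ n)) (down -[1+ n ] (ℤ-induction P base up down -[1+ n ]))

  negOnePow-suc : ∀ k → negOnePow (k + 1ℤ) ≡ opposite (negOnePow k)
  negOnePow-suc (+ n)           = cong parityℕ (ℕₚ.+-comm n 1)
  negOnePow-suc -[1+ zero ]     = refl
  negOnePow-suc -[1+ suc n ]    =
    trans (cong negOnePow (trans (ℤₚ.[1+m]⊖[1+n]≡m⊖n 0 (suc n)) (ℤₚ.⊖-swap 0 (suc n))))
          (sym (𝕊.opposite-involutive (parityℕ (suc n))))

  negOnePow-pred : ∀ k → negOnePow (k - 1ℤ) ≡ opposite (negOnePow k)
  negOnePow-pred k = trans (sym (𝕊.opposite-involutive _))
    (cong opposite (trans (sym (negOnePow-suc (k - 1ℤ))) (cong negOnePow (cancel k))))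
    where
    cancel : ∀ k → k - 1ℤ + 1ℤ ≡ k
    cancel = solve-∀

  negOnePow-+ : ∀ x y → negOnePow (x + y) ≡ negOnePow x *ₛ negOnePow y
  negOnePow-+ x = ℤ-induction P base up down
    where
    P : ℤ → Set
    P y = negOnePow (x + y) ≡ negOnePow x *ₛ negOnePow y
    base : P (+ 0)
    base = trans (cong negOnePow (ℤₚ.+-identityʳ x)) (sym (𝕊.*-identityʳ (negOnePow x)))
    up : ∀ y → P y → P (y + 1ℤ)
    up y hyp = begin
      negOnePow (x + (y + 1ℤ))                ≡⟨ cong negOnePow (ℤₚ.+-assoc x y 1ℤ) ⟨
      negOnePow (x + y + 1ℤ)                  ≡⟨ negOnePow-suc (x + y) ⟩
      opposite (negOnePow (x + y))            ≡⟨ cong opposite hyp ⟩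
      opposite (negOnePow x *ₛ negOnePow y)   ≡⟨ opposite-*ʳ (negOnePow x) (negOnePow y) ⟩
      negOnePow x *ₛ opposite (negOnePow y)   ≡⟨ cong (negOnePow x *ₛ_) (negOnePow-suc y) ⟨
      negOnePow x *ₛ negOnePow (y + 1ℤ)       ∎
      where open ≡-Reasoning
    down : ∀ y → P y → P (y - 1ℤ)
    down y hyp = begin
      negOnePow (x + (y - 1ℤ))                ≡⟨ cong negOnePow (ℤₚ.+-assoc x y (- 1ℤ)) ⟨
      negOnePow (x + y - 1ℤ)                  ≡⟨ negOnePow-pred (x + y) ⟩
      opposite (negOnePow (x + y))            ≡⟨ cong opposite hyp ⟩
      opposite (negOnePow x *ₛ negOnePow y)   ≡⟨ opposite-*ʳ (negOnePow x) (negOnePow y) ⟩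
      negOnePow x *ₛ opposite (negOnePow y)   ≡⟨ cong (negOnePow x *ₛ_) (negOnePow-pred y) ⟨
      negOnePow x *ₛ negOnePow (y - 1ℤ)       ∎
      where open ≡-Reasoning

  Alternating : (ℤ → Sign) → ℤ → ℕ → Set
  Alternating a h L = ∀ k → a (h + k * + L) ≡ negOnePow k *ₛ a h

  window≡applyUpTo : ∀ a i m → window a i m ≡ applyUpTo (λ x → a (i + + x)) m
  window≡applyUpTo a i zero    = refl
  window≡applyUpTo a i (suc m) = cong₂ _∷_ (cong a (sym (ℤₚ.+-identityʳ i)))
    (trans (window≡applyUpTo a (i + + 1) m) (applyUpTo-cong m λ x _ → cong a (ℤₚ.+-assoc i (+ 1) (+ x))))

  recover : ∀ c h → c + (h - c) ≡ h
  recover = solve-∀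

  ℤ-even-or-odd : ∀ q → (∃[ r ] q ≡ r + r) ⊎ (∃[ r ] q ≡ 1ℤ + (r + r))
  ℤ-even-or-odd (+ n) with evenOdd n
  ... | even m = inj₁ (+ m , refl)
  ... | odd  m = inj₂ (+ m , refl)
  ℤ-even-or-odd -[1+ n ] with evenOdd n
  ... | even m = inj₂ (-[1+ m ] , odd-negative (+ m))
    where
    odd-negative : ∀ x → - (1ℤ + (x + x)) ≡ 1ℤ + (- (1ℤ + x) + - (1ℤ + x))
    odd-negative = solve-∀
  ... | odd  m = inj₁ (-[1+ m ] , refl)

  valuation-dichotomy : ∀ M d → (∃[ q ] d ≡ q * + pow2 M) ⊎
                                (∃[ v ] v ℕ.< M × ∃[ j ] d ≡ + pow2 v + j * + pow2 (suc v))
  valuation-dichotomy zero d = inj₁ (d , sym (ℤₚ.*-identityʳ d))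
  valuation-dichotomy (suc M) d with valuation-dichotomy M d
  ... | inj₂ (v , v<M , odd-multiple) = inj₂ (v , ℕₚ.m<n⇒m<1+n v<M , odd-multiple)
  ... | inj₁ (q , d≡) with ℤ-even-or-odd q
  ...   | inj₁ (r , refl) = inj₁ (r , trans d≡ (double r (+ pow2 M)))
    where
    double : ∀ r P → (r + r) * P ≡ r * (P + P)
    double = solve-∀
  ...   | inj₂ (r , refl) = inj₂ (M , ℕₚ.n<1+n M , r , trans d≡ (odd-multiple r (+ pow2 M)))
    where
    odd-multiple : ∀ r P → (1ℤ + (r + r)) * P ≡ P + r * (P + P)
    odd-multiple = solve-∀

-- From complete folding to alternation: windows of a are segments of paperfolding words,
-- in which alternation at three consecutive points of a progression of step 2^(n+1)
-- propagates along the whole progression.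
module Forward (a : ℤ → Sign) (complete : CompleteFolding a) (n : ℕ) where

  open Paperfolding
  open Rigidity
  open OverIntegers
  open import Data.Nat as ℕ using (suc; z≤n; s≤s)
  import Data.Nat.Properties as ℕₚ
  open import Data.Integer using (+_; -[1+_]; _+_; _*_; -_)
  import Data.Integer.Properties as ℤₚ
  open import Data.Integer.Tactic.RingSolver using (solve-∀)
  open import Data.Product using (∃-syntax; _,_)
  open import Function using (_∘_)
  open import Relation.Binary.PropositionalEquality

  L : ℕ
  L = pow2 (suc n)

  window-foldSign : ∀ y m → ∃[ t ] ∃[ d ] ∀ x → x ℕ.< m → a (y + + x) ≡ foldSign t (suc d ℕ.+ x)
  window-foldSign y m with complete y m
  ... | N , S , folding , subword with folding-isFoldWord folding
  ...   | t , refl = t , subword-of-applyUpTo (subst (λ w → SubwordOf w (foldWord t N)) (window≡applyUpTo a y m) subword)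

  sample : ℤ → ℕ → Sign
  sample y i = a (y + + (i ℕ.* L))

  sample-window : ∀ y M → ∃[ t ] ∃[ s ] ∀ i → i ℕ.≤ M → sample y i ≡ progression t s L i
  sample-window y M with window-foldSign y (suc (M ℕ.* L))
  ... | t , d , agree = t , suc d , λ i i≤M → agree (i ℕ.* L) (s≤s (ℕₚ.*-monoˡ-≤ L i≤M))

  alternation-spreads : ∀ y m M → 3 ℕ.+ m ℕ.≤ M → ThreeFlips (sample y) m →
                        ∀ i → i ℕ.≤ M → sample y i ≡ parityℕ i *ₛ sample y 0
  alternation-spreads y m M m+3≤M three i i≤M with sample-window y M
  ... | t , s , agree = begin
    sample y i                 ≡⟨ agree i i≤M ⟩
    u i                        ≡⟨ alternating-from-flips (progression-rigid n t s m flips) i ⟩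
    parityℕ i *ₛ u 0           ≡⟨ cong (parityℕ i *ₛ_) (sym (agree 0 z≤n)) ⟩
    parityℕ i *ₛ sample y 0    ∎
    where
    open ≡-Reasoning
    u = progression t s L
    flips : ThreeFlips u m
    flips = ThreeFlips-transfer (sample y) u m m
      (λ j j≤3 → sym (agree (j ℕ.+ m) (ℕₚ.≤-trans (ℕₚ.+-monoˡ-≤ m j≤3) m+3≤M))) three

  -- A base point: in the window at 0, move to a position of valuation n, where the
  -- paperfolding signs alternate with step L.
  base-point : ∃[ h ] ThreeFlips (sample h) 0
  base-point with window-foldSign (+ 0) (suc (4 ℕ.* L))
  ... | t , d , agree with dyadic-within n (suc d)
  ...   | e , e<L , j , e≡ = + e , ThreeFlips-transfer (progression t (dyadic n j) L) (sample (+ e)) 0 0 close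
                                     (dyadic-flips n t j 0 , dyadic-flips n t j 1 , dyadic-flips n t j 2)
    where
    close : ∀ i → i ℕ.≤ 3 → sample (+ e) (i ℕ.+ 0) ≡ progression t (dyadic n j) L (i ℕ.+ 0)
    close i i≤3 = trans (agree (e ℕ.+ k ℕ.* L) (s≤s inside))
                        (cong (foldSign t) (trans (sym (ℕₚ.+-assoc (suc d) e (k ℕ.* L))) (cong (ℕ._+ k ℕ.* L) e≡)))
      where
      k = i ℕ.+ 0
      inside : e ℕ.+ k ℕ.* L ℕ.≤ 4 ℕ.* L
      inside = ℕₚ.+-mono-≤ (ℕₚ.<⇒≤ e<L) (ℕₚ.*-monoˡ-≤ L (ℕₚ.≤-trans (ℕₚ.≤-reflexive (ℕₚ.+-identityʳ i)) i≤3))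

  sample-back : ∀ h N i → sample (h + -[1+ N ] * + L) (i ℕ.+ suc N) ≡ sample h i
  sample-back h N i = cong a (begin
    h + -[1+ N ] * + L + + ((i ℕ.+ suc N) ℕ.* L)   ≡⟨ cong (λ z → h + -[1+ N ] * + L + z) cast ⟩
    h + - + suc N * + L + (+ i + + suc N) * + L     ≡⟨ cancel h (+ suc N) (+ i) (+ L) ⟩
    h + + i * + L                                   ≡⟨ cong (λ z → h + z) (sym (ℤₚ.pos-* i L)) ⟩
    h + + (i ℕ.* L)                                 ∎)
    where
    open ≡-Reasoning
    cast : + ((i ℕ.+ suc N) ℕ.* L) ≡ (+ i + + suc N) * + L
    cast = trans (ℤₚ.pos-* (i ℕ.+ suc N) L) (cong (_* + L) (ℤₚ.pos-+ i (suc N)))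
    cancel : ∀ h S I L → h + - S * L + (I + S) * L ≡ h + I * L
    cancel = solve-∀

  -- a alternates with period L through the base point: for k ≥ 0 use a window starting at
  -- h, for k < 0 one starting k periods earlier.
  forward : ∃[ h ] Alternating a h L
  forward with base-point
  ... | h , three = h , alternates
    where
    open ≡-Reasoning
    start : ∀ y → sample y 0 ≡ a y
    start y = cong a (ℤₚ.+-identityʳ y)
    alternates : Alternating a h L
    alternates (+ N) = begin
      a (h + + N * + L)           ≡⟨ cong (λ z → a (h + z)) (sym (ℤₚ.pos-* N L)) ⟩
      sample h N                  ≡⟨ alternation-spreads h 0 (3 ℕ.+ N) (ℕₚ.m≤m+n 3 N) three N (ℕₚ.m≤n+m N 3) ⟩
      parityℕ N *ₛ sample h 0     ≡⟨ cong (parityℕ N *ₛ_) (start h) ⟩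
      parityℕ N *ₛ a h            ∎
    alternates -[1+ N ] = sign-transpose (parityℕ (suc N)) (a h) (a y) (begin
      a h                               ≡⟨ sym (start h) ⟩
      sample h 0                        ≡⟨ sym (sample-back h N 0) ⟩
      sample y (suc N)
        ≡⟨ alternation-spreads y (suc N) (3 ℕ.+ suc N) ℕₚ.≤-refl three′ (suc N) (ℕₚ.m≤n+m (suc N) 3) ⟩
      parityℕ (suc N) *ₛ sample y 0     ≡⟨ cong (parityℕ (suc N) *ₛ_) (start y) ⟩
      parityℕ (suc N) *ₛ a y            ∎)
      where
      y = h + -[1+ N ] * + L
      three′ : ThreeFlips (sample y) (suc N)
      three′ = ThreeFlips-transfer (sample h) (sample y) 0 (suc N)
                 (λ i _ → trans (sample-back h N i) (cong (sample h) (sym (ℕₚ.+-identityʳ i)))) three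


-- From alternation to complete folding: alternation at every level n yields points c
-- around which a is a paperfolding sign function up to any prescribed length.
module Backward (a : ℤ → Sign) where

  open Paperfolding
  open OverIntegers
  open import Data.Nat as ℕ using (zero; suc; z<s)
  import Data.Nat.Properties as ℕₚ
  open import Data.Integer using (+_; _+_; _*_; _-_; 1ℤ)
  import Data.Integer.Properties as ℤₚ
  open import Data.Integer.Tactic.RingSolver using (solve-∀)
  import Data.Sign.Properties as 𝕊
  open import Data.Product using (∃-syntax; _×_; _,_)
  open import Data.Integer.DivMod using (n%ℕd<d; a≡a%ℕn+[a/ℕn]*n)
  open import Data.Integer.Base using (_/ℕ_; _%ℕ_)
  open import Data.List using (applyUpTo)
  open import Data.Sum using (inj₁; inj₂)
  open import Data.Empty using (⊥)
  open import Function using (_∘_)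
  open import Relation.Nullary using (yes; no; contradiction)
  open import Relation.Binary.PropositionalEquality

  Alternating-shift : ∀ {c L} → Alternating a c L → ∀ q → Alternating a (c + q * + L) L
  Alternating-shift {c} {L} alt q k = begin
    a (c + q * + L + k * + L)              ≡⟨ cong a (regroup c q k (+ L)) ⟩
    a (c + (q + k) * + L)                  ≡⟨ alt (q + k) ⟩
    negOnePow (q + k) *ₛ a c               ≡⟨ cong (_*ₛ a c) (negOnePow-+ q k) ⟩
    (negOnePow q *ₛ negOnePow k) *ₛ a c    ≡⟨ cong (_*ₛ a c) (𝕊.*-comm (negOnePow q) (negOnePow k)) ⟩
    (negOnePow k *ₛ negOnePow q) *ₛ a c    ≡⟨ 𝕊.*-assoc (negOnePow k) (negOnePow q) (a c) ⟩
    negOnePow k *ₛ (negOnePow q *ₛ a c)    ≡⟨ cong (negOnePow k *ₛ_) (sym (alt q)) ⟩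
    negOnePow k *ₛ a (c + q * + L)         ∎
    where
    open ≡-Reasoning
    regroup : ∀ c q k L → c + q * L + k * L ≡ c + (q + k) * L
    regroup = solve-∀

  pow2-split : ∀ v w → + pow2 (suc v ℕ.+ w) ≡ + pow2 w * + pow2 (suc v)
  pow2-split v w = begin
    + pow2 (suc v ℕ.+ w)                ≡⟨ cong +_ (pow2-+ (suc v) w) ⟩
    + (pow2 (suc v) ℕ.* pow2 w)         ≡⟨ ℤₚ.pos-* (pow2 (suc v)) (pow2 w) ⟩
    + pow2 (suc v) * + pow2 w           ≡⟨ ℤₚ.*-comm (+ pow2 (suc v)) (+ pow2 w) ⟩
    + pow2 w * + pow2 (suc v)           ∎
    where open ≡-Reasoning

  -- Period 2^(M+1) is an even multiple of 2^(v+1) for v < M, so a cannot alternate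
  -- through one point at two different levels.
  no-two-levels : ∀ {h v M} → v ℕ.< M → Alternating a h (pow2 (suc v)) → Alternating a h (pow2 (suc M)) → ⊥
  no-two-levels {h} {v} v<M alt-v alt-M with ℕₚ.m≤n⇒∃[o]m+o≡n v<M
  ... | w , refl = 𝕊.s≢opposite[s] (a h) (begin
    a h                                        ≡⟨ sym (cong (_*ₛ a h) (parityℕ-double (pow2 w))) ⟩
    negOnePow (+ pow2 (suc w)) *ₛ a h          ≡⟨ sym (alt-v (+ pow2 (suc w))) ⟩
    a (h + + pow2 (suc w) * + pow2 (suc v))    ≡⟨ cong (λ z → a (h + z)) (sym (trans (ℤₚ.*-identityˡ _) period)) ⟩
    a (h + 1ℤ * + pow2 (suc (suc v ℕ.+ w)))    ≡⟨ alt-M 1ℤ ⟩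
    opposite (a h)                             ∎)
    where
    open ≡-Reasoning
    period : + pow2 (suc (suc v ℕ.+ w)) ≡ + pow2 (suc w) * + pow2 (suc v)
    period = trans (cong (+_ ∘ pow2) (sym (ℕₚ.+-suc (suc v) w))) (pow2-split v (suc w))

  -- c is an anchor below level M if a alternates with period 2^(v+1) through c + 2^v for
  -- every v < M; then a (c + p) is the paperfolding sign for the choices v ↦ a (c + 2^v).
  Anchored : ℤ → ℕ → Set
  Anchored c M = ∀ v → v ℕ.< M → Alternating a (c + + pow2 v) (pow2 (suc v))

  Anchored-shift : ∀ {c M} → Anchored c M → ∀ q → Anchored (c + q * + pow2 M) M
  Anchored-shift {c} anchored q v v<M with ℕₚ.m≤n⇒∃[o]m+o≡n v<M
  ... | w , refl = subst (λ x → Alternating a x (pow2 (suc v))) (moved (pow2-split v w))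
                         (Alternating-shift (anchored v v<M) (q * + pow2 w))
    where
    moved : ∀ {P} → P ≡ + pow2 w * + pow2 (suc v) →
            c + + pow2 v + q * + pow2 w * + pow2 (suc v) ≡ c + q * P + + pow2 v
    moved refl = regroup c (+ pow2 v) q (+ pow2 w) (+ pow2 (suc v))
      where
      regroup : ∀ c p q W V → c + p + q * W * V ≡ c + q * (W * V) + p
      regroup = solve-∀

  -- Alternation at every level yields anchors below every level: an anchor below M and the
  -- alternation point h at level M are compatible, since h − c cannot be an odd multiple
  -- of 2^v with v < M (no-two-levels), so h − c is a multiple of 2^M.
  anchor-exists : (∀ n → ∃[ h ] Alternating a h (pow2 (suc n))) → ∀ M → ∃[ c ] Anchored c M
  anchor-exists alts zero = + 0 , λ v ()
  anchor-exists alts (suc M) with anchor-exists alts M | alts M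
  ... | c , anchored | h , alt-h with valuation-dichotomy M (h - c)
  ...   | inj₂ (v , v<M , j , h-c≡) = contradiction alt-h (no-two-levels v<M alt-v)
    where
    alt-v : Alternating a h (pow2 (suc v))
    alt-v = subst (λ x → Alternating a x (pow2 (suc v)))
                  (trans (ℤₚ.+-assoc c _ _) (trans (cong (λ z → c + z) (sym h-c≡)) (recover c h)))
                  (Alternating-shift (anchored v v<M) j)
  ...   | inj₁ (q , h-c≡) = c′ , anchored′
    where
    P = + pow2 M
    c′ = c + (q - 1ℤ) * P
    c′+P≡h : c′ + P ≡ h
    c′+P≡h = trans (step-back c q P) (trans (cong (λ z → c + z) (sym h-c≡)) (recover c h))
      where
      step-back : ∀ c q P → c + (q - 1ℤ) * P + P ≡ c + q * P
      step-back = solve-∀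
    anchored′ : Anchored c′ (suc M)
    anchored′ v v<1+M with ℕₚ.m<1+n⇒m<n∨m≡n v<1+M
    ... | inj₁ v<M  = Anchored-shift {c} anchored (q - 1ℤ) v v<M
    ... | inj₂ refl = subst (λ x → Alternating a x (pow2 (suc M))) (sym c′+P≡h) alt-h

  -- Around an anchor c below m, a agrees with the paperfolding signs on (c, c + 2^(m+1)):
  -- the position 2^v (2j+1) lies on the alternation through c + 2^v, or is 2^m itself.
  anchored-foldSign : ∀ {c m} → Anchored c m → ∀ p → 1 ℕ.≤ p → p ℕ.< pow2 (suc m) →
                      a (c + + p) ≡ foldSign (λ v → a (c + + pow2 v)) p
  anchored-foldSign {c} {m} anchored p 1≤p p< with dyadic-decomposition p 1≤p
  ... | v , j , refl with v ℕ.<? m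
  ...   | yes v<m = begin
    a (c + + dyadic v j)                                 ≡⟨ cong a (on-progression v j) ⟩
    a (c + + pow2 v + + j * + pow2 (suc v))              ≡⟨ anchored v v<m (+ j) ⟩
    parityℕ j *ₛ t v                                     ≡⟨ sym (foldSign-dyadic t v j) ⟩
    foldSign t (dyadic v j)                              ∎
    where
    open ≡-Reasoning
    t = λ v → a (c + + pow2 v)
    on-progression : ∀ v j → c + + dyadic v j ≡ c + + pow2 v + + j * + pow2 (suc v)
    on-progression v j = begin
      c + + dyadic v j                                   ≡⟨ cong (λ z → c + + z) (dyadic≡ v j) ⟩
      c + (+ pow2 v + + (j ℕ.* pow2 (suc v)))            ≡⟨ cong (λ z → c + (+ pow2 v + z)) (ℤₚ.pos-* j (pow2 (suc v))) ⟩
      c + (+ pow2 v + + j * + pow2 (suc v))              ≡⟨ sym (ℤₚ.+-assoc c (+ pow2 v) _) ⟩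
      c + + pow2 v + + j * + pow2 (suc v)                ∎
  ...   | no v≮m with dyadic-below m v j p< v≮m
  ...     | refl , refl = begin
    a (c + + dyadic m 0)                                 ≡⟨ cong (λ z → a (c + + z)) (dyadic-zero m) ⟩
    a (c + + pow2 m)                                     ≡⟨ sym (foldSign-pow2 (λ v → a (c + + pow2 v)) m) ⟩
    foldSign (λ v → a (c + + pow2 v)) (pow2 m)           ≡⟨ cong (foldSign (λ v → a (c + + pow2 v))) (sym (dyadic-zero m)) ⟩
    foldSign (λ v → a (c + + pow2 v)) (dyadic m 0)       ∎
    where open ≡-Reasoning

  euclidean-position : ∀ i c m → ∃[ q ] ∃[ r ] r ℕ.< pow2 m × i ≡ c + q * + pow2 m + + suc r
  euclidean-position i c m = δ /ℕ D , δ %ℕ D , subst (δ %ℕ D ℕ.<_) D≡ (n%ℕd<d δ D) , (begin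
    i                                          ≡⟨ sym (unfold i c) ⟩
    c + (1ℤ + δ)                               ≡⟨ cong (λ z → c + (1ℤ + z)) (a≡a%ℕn+[a/ℕn]*n δ D) ⟩
    c + (1ℤ + (+ (δ %ℕ D) + δ /ℕ D * + D))     ≡⟨ regroup c (δ /ℕ D) (+ D) (+ (δ %ℕ D)) ⟩
    c + δ /ℕ D * + D + + suc (δ %ℕ D)          ≡⟨ cong (λ P → c + δ /ℕ D * + P + + suc (δ %ℕ D)) D≡ ⟩
    c + δ /ℕ D * + pow2 m + + suc (δ %ℕ D)     ∎)
    where
    open ≡-Reasoning
    D = suc (foldLength m)
    D≡ : D ≡ pow2 m
    D≡ = suc-foldLength m
    δ = i - c - 1ℤ
    unfold : ∀ i c → c + (1ℤ + (i - c - 1ℤ)) ≡ i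
    unfold = solve-∀
    regroup : ∀ c q D r → c + (1ℤ + (r + q * D)) ≡ c + q * D + (1ℤ + r)
    regroup = solve-∀

  backward : (∀ n → ∃[ h ] Alternating a h (pow2 (suc n))) → CompleteFolding a
  backward alts i m with anchor-exists alts m
  ... | c , anchored with euclidean-position i c m
  ...   | q , r , r< , i≡ = suc m , foldWord t (suc m) , foldWord-isFolding (suc m) t , subword
    where
    c₀ = c + q * + pow2 m
    t : ℕ → Sign
    t v = a (c₀ + + pow2 v)
    P = pow2 m
    m<P : m ℕ.< P
    m<P = n<pow2 m
    bound : ∀ x → x ℕ.< m → suc (r ℕ.+ x) ℕ.< pow2 (suc m)
    bound x x<m = subst (ℕ._≤ P ℕ.+ P) (ℕₚ.+-suc (suc r) x) (ℕₚ.+-mono-≤ r< (ℕₚ.<-trans x<m m<P))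
    window≡ : window a i m ≡ applyUpTo (λ x → foldSign t (suc (r ℕ.+ x))) m
    window≡ = trans (window≡applyUpTo a i m) (applyUpTo-cong m λ x x<m →
      trans (cong a (trans (cong (_+ + x) i≡) (ℤₚ.+-assoc c₀ (+ suc r) (+ x))))
            (anchored-foldSign {c₀} (Anchored-shift {c} anchored q) (suc (r ℕ.+ x)) z<s (bound x x<m)))
    fits : r ℕ.+ m ℕ.≤ foldLength (suc m)
    fits = ℕₚ.+-mono-≤ (ℕₚ.≤-pred (subst (r ℕ.<_) (sym (suc-foldLength m)) r<))
                       (ℕₚ.<⇒≤ (subst (m ℕ.<_) (sym (suc-foldLength m)) m<P))
    subword : SubwordOf (window a i m) (foldWord t (suc m))
    subword = subst (λ w → SubwordOf w (foldWord t (suc m))) (sym window≡)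
                    (applyUpTo-segment r m (foldLength (suc m)) (foldSign t ∘ suc) fits)

open import Data.Nat using (suc; _^_)
open import Data.Integer using (+_; _+_; _*_)
open import Data.Product using (∃-syntax)
open import Function.Bundles using (_⇔_; mk⇔)
open import Relation.Binary.PropositionalEquality using (_≡_; subst; sym)
open Paperfolding using (pow2; pow2≡2^)
open OverIntegers using (Alternating)

corollary1p2 : (a : ℤ → Sign) →
    CompleteFolding a ⇔
      (∀ (n : ℕ) → ∃[ h ] ∀ (k : ℤ) → a (h + k * + (2 ^ suc n)) ≡ negOnePow k *ₛ a h)
corollary1p2 a = mk⇔ to from
  where
  AlternatesWithPeriod : ℕ → Set
  AlternatesWithPeriod L = ∃[ h ] Alternating a h L
  to : CompleteFolding a → ∀ n → AlternatesWithPeriod (2 ^ suc n)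
  to complete n = subst AlternatesWithPeriod (pow2≡2^ (suc n)) (Forward.forward a complete n)
  from : (∀ n → AlternatesWithPeriod (2 ^ suc n)) → CompleteFolding a
  from alternates = Backward.backward a λ n → subst AlternatesWithPeriod (sym (pow2≡2^ (suc n))) (alternates n)
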